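{- Let $n$ and $k$ be positive integers. If every Latin array of order $n$ contains a partial transversal of length $k$, then every Latin array of order $n+1$ contains a partial transversal of length $k$.
   Context: A Latin array of order $n$ is an $n\times n$ matrix each of whose cells contains a symbol (from an arbitrary set of symbols) such that no symbol occurs more than once in any row or in any column. An entry is a triple $(r,c,s)$ where $s$ is the symbol in cell $(r,c)$. A partial transversal of length $\ell$ is a set of $\ell$ entries from pairwise distinct rows and pairwise distinct columns whose symbols are pairwise distinct. -}

module Defs where

open import Data.Nat using (ℕ)
open import Data.Fin using (Fin)
open import Data.Product using (Σ; _×_)
open import Function.Definitions using (Injective)
open import Relation.Binary.PropositionalEquality using (_≡_)

Array : ℕ → Set → Set
Array n S = Fin n → Fin n → S

IsLatin : {n : ℕ} {S : Set} → Array n S → Set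
IsLatin {n} A =
  ((r : Fin n) → Injective _≡_ _≡_ (λ c → A r c)) ×
  ((c : Fin n) → Injective _≡_ _≡_ (λ r → A r c))

PartialTransversal : {n : ℕ} {S : Set} → Array n S → ℕ → Set
PartialTransversal {n} A ℓ =
  Σ (Fin ℓ → Fin n) λ row →
  Σ (Fin ℓ → Fin n) λ col →
    Injective _≡_ _≡_ row ×
    Injective _≡_ _≡_ col ×
    Injective _≡_ _≡_ (λ i → A (row i) (col i))

AllLatinHavePT : ℕ → ℕ → Set₁
AllLatinHavePT n k =
  (S : Set) (A : Array n S) → IsLatin A → PartialTransversal A k

module Submission where

-- Idea: a Latin array of order n+1 contains a Latin subarray of order n
-- (delete the last row and column), and a partial transversal of a
-- subarray is also a partial transversal of the whole array.

open import Defs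
open import Data.Nat using (ℕ; suc; _≤_)
open import Data.Nat.Properties using (n≤1+n)
open import Data.Fin using (Fin; inject≤)
open import Data.Fin.Properties using (inject≤-injective)
open import Data.Product using (_,_)
open import Function.Base using (_∘_)
open import Function.Definitions using (Injective)
open import Function.Construct.Composition using (injective)
open import Relation.Binary.PropositionalEquality using (_≡_)

restrict : {m n : ℕ} {S : Set} → (Fin m → Fin n) → (Fin m → Fin n) →
  Array n S → Array m S
restrict ρ γ A r c = A (ρ r) (γ c)

∘-injective : {X Y Z : Set} {f : X → Y} {g : Y → Z} →
  Injective _≡_ _≡_ f → Injective _≡_ _≡_ g → Injective _≡_ _≡_ (g ∘ f)
∘-injective = injective _≡_ _≡_ _≡_

restriction-latin : {m n : ℕ} {S : Set} {ρ γ : Fin m → Fin n} (A : Array n S) →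
  Injective _≡_ _≡_ ρ → Injective _≡_ _≡_ γ →
  IsLatin A → IsLatin (restrict ρ γ A)
restriction-latin A ρ-inj γ-inj (rows-inj , cols-inj) =
  (λ r → ∘-injective γ-inj (rows-inj _)) ,
  (λ c → ∘-injective ρ-inj (cols-inj _))

restriction-transversal : {m n ℓ : ℕ} {S : Set} {ρ γ : Fin m → Fin n}
  (A : Array n S) → Injective _≡_ _≡_ ρ → Injective _≡_ _≡_ γ →
  PartialTransversal (restrict ρ γ A) ℓ → PartialTransversal A ℓ
restriction-transversal {ρ = ρ} {γ} A ρ-inj γ-inj
  (row , col , row-inj , col-inj , sym-inj) =
  ρ ∘ row , γ ∘ col ,
  ∘-injective row-inj ρ-inj , ∘-injective col-inj γ-inj , sym-inj

allLatinHavePT-mono : {m n k : ℕ} → m ≤ n →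
  AllLatinHavePT m k → AllLatinHavePT n k
allLatinHavePT-mono {m} m≤n hyp S A latin =
  restriction-transversal A embed-inj embed-inj
    (hyp S (restrict embed embed A)
      (restriction-latin A embed-inj embed-inj latin))
  where
  embed : Fin m → Fin _
  embed i = inject≤ i m≤n

  embed-inj : Injective _≡_ _≡_ embed
  embed-inj = inject≤-injective m≤n m≤n _ _

-- The theorem: the case n ≤ n + 1 of monotonicity.
lemma2p1 : (n k : ℕ) → 1 ≤ n → 1 ≤ k →
    AllLatinHavePT n k → AllLatinHavePT (suc n) k
lemma2p1 n k _ _ = allLatinHavePT-mono (n≤1+n n)
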